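{- Let $n$ be a positive integer and $u$ a nonnegative integer. Let $\sigma_{u}(t)$ be the sequence of length $n(u+1)$ in which each of $1+t,2+t,\dots,n+t$ appears exactly $u+1$ times. Then, as a polynomial identity in $t$, $$\nu(\sigma_u(t))=-\frac n2(u+1)(2t+n+1)\Big(t(t+1)-u\Big(\frac{n(n+1)}2+nt\Big)\Big).$$
   Context: For a finite sequence $(a_1,\dots,a_N)$ (repetitions allowed, order irrelevant), $\nu(a_1,\dots,a_N)=\big(\sum a_i\big)^2-\sum a_i^3$. -}

module Defs where

open import Data.Nat using (ℕ; suc)
open import Data.Integer using (+_)
open import Data.Rational using (ℚ; 0ℚ; _+_; _*_; _-_; _/_)
open import Data.List using (List; foldr; map; replicate; concatMap; upTo)

sumℚ : List ℚ → ℚ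
sumℚ = foldr _+_ 0ℚ

ℕ→ℚ : ℕ → ℚ
ℕ→ℚ k = (+ k) / 1

ν : List ℚ → ℚ
ν as = sumℚ as * sumℚ as - sumℚ (map (λ a → a * a * a) as)

σ : ℕ → ℕ → ℚ → List ℚ
σ n u t = concatMap (λ i → replicate (suc u) (ℕ→ℚ (suc i) + t)) (upTo n)

{-# OPTIONS --safe #-}
-- Every element 1 + t, …, n + t occurs u + 1 times, so both sums in ν are u + 1 times the power
-- sums Σᵢ (i + t) and Σᵢ (i + t)³.  These are polynomials in n, obtained by telescoping against
-- their discrete antiderivatives, and the theorem becomes a polynomial identity in n, u and t.
module Submission where

open import Defs
open import Data.Nat using (ℕ; _≤_)
open import Data.Rational using (ℚ; 1ℚ; ½; _+_; _*_; _-_; -_)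
open import Relation.Binary.PropositionalEquality using (_≡_)

import Data.Integer.Base as ℤ
import Data.Integer.Tactic.RingSolver as ℤ-Solver
open import Data.List.Base using ([]; _∷_; _++_; [_]; map; replicate; concatMap; upTo)
open import Data.List.Properties using (applyUpTo-∷ʳ; map-++; map-replicate; map-id)
open import Data.Nat.Base as ℕ using (suc; zero)
open import Data.Rational.Base using (0ℚ; toℚᵘ)
open import Data.Rational.Properties
  using (_≟_; +-*-commutativeRing; +-identityʳ; +-identityˡ; +-assoc; +-comm; *-zeroˡ; *-zeroʳ;
         *-distribˡ-+; toℚᵘ-injective; toℚᵘ-homo-+; toℚᵘ-fromℚᵘ)
import Data.Rational.Unnormalised.Base as ℚᵘ
import Data.Rational.Unnormalised.Properties as ℚᵘ
open import Function.Base using (id; _∘_)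
open import Level using (0ℓ)
open import Relation.Binary.PropositionalEquality using (sym; trans; cong; cong₂; module ≡-Reasoning)
open import Relation.Nullary.Decidable.Core using (dec⇒maybe)
open import Tactic.RingSolver using (solve-∀)
open import Tactic.RingSolver.Core.AlmostCommutativeRing using (AlmostCommutativeRing; fromCommutativeRing)

ℚ-ring : AlmostCommutativeRing 0ℓ 0ℓ
ℚ-ring = fromCommutativeRing +-*-commutativeRing (λ x → dec⇒maybe (0ℚ ≟ x))

ℕ→ℚ-+ : ∀ m n → ℕ→ℚ (m ℕ.+ n) ≡ ℕ→ℚ m + ℕ→ℚ n
ℕ→ℚ-+ m n = toℚᵘ-injective (begin
  toℚᵘ (ℕ→ℚ (m ℕ.+ n))             ≈⟨ toℚᵘ-ℕ→ℚ (m ℕ.+ n) ⟩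
  ℚᵘ.mkℚᵘ (ℤ.+ m ℤ.+ ℤ.+ n) 0       ≈⟨ ℚᵘ.*≡* (sum-over-1 (ℤ.+ m) (ℤ.+ n)) ⟩
  ℚᵘ.mkℚᵘ (ℤ.+ m) 0 ℚᵘ.+ ℚᵘ.mkℚᵘ (ℤ.+ n) 0
    ≈⟨ ℚᵘ.+-cong (ℚᵘ.≃-sym (toℚᵘ-ℕ→ℚ m)) (ℚᵘ.≃-sym (toℚᵘ-ℕ→ℚ n)) ⟩
  toℚᵘ (ℕ→ℚ m) ℚᵘ.+ toℚᵘ (ℕ→ℚ n)   ≈⟨ ℚᵘ.≃-sym (toℚᵘ-homo-+ (ℕ→ℚ m) (ℕ→ℚ n)) ⟩
  toℚᵘ (ℕ→ℚ m + ℕ→ℚ n)             ∎)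
  where
  open ℚᵘ.≃-Reasoning
  toℚᵘ-ℕ→ℚ : ∀ k → toℚᵘ (ℕ→ℚ k) ℚᵘ.≃ ℚᵘ.mkℚᵘ (ℤ.+ k) 0
  toℚᵘ-ℕ→ℚ k = toℚᵘ-fromℚᵘ (ℚᵘ.mkℚᵘ (ℤ.+ k) 0)
  sum-over-1 : ∀ a b → (a ℤ.+ b) ℤ.* ℤ.+ 1 ≡ (a ℤ.* ℤ.+ 1 ℤ.+ b ℤ.* ℤ.+ 1) ℤ.* ℤ.+ 1
  sum-over-1 = ℤ-Solver.solve-∀

ℕ→ℚ-suc : ∀ n → ℕ→ℚ (suc n) ≡ ℕ→ℚ n + 1ℚ
ℕ→ℚ-suc n = trans (ℕ→ℚ-+ 1 n) (+-comm 1ℚ (ℕ→ℚ n))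

sumℚ-++ : ∀ xs ys → sumℚ (xs ++ ys) ≡ sumℚ xs + sumℚ ys
sumℚ-++ []       ys = sym (+-identityˡ (sumℚ ys))
sumℚ-++ (x ∷ xs) ys = trans (cong (x +_) (sumℚ-++ xs ys)) (sym (+-assoc x (sumℚ xs) (sumℚ ys)))

sumℚ-replicate : ∀ k x → sumℚ (replicate k x) ≡ ℕ→ℚ k * x
sumℚ-replicate zero    x = sym (*-zeroˡ x)
sumℚ-replicate (suc k) x = begin
  x + sumℚ (replicate k x)  ≡⟨ cong (x +_) (sumℚ-replicate k x) ⟩
  x + ℕ→ℚ k * x             ≡⟨ absorb (ℕ→ℚ k) x ⟩
  (ℕ→ℚ k + 1ℚ) * x          ≡⟨ cong (_* x) (sym (ℕ→ℚ-suc k)) ⟩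
  ℕ→ℚ (suc k) * x           ∎
  where
  open ≡-Reasoning
  absorb : ∀ a x → x + a * x ≡ (a + 1ℚ) * x
  absorb = solve-∀ ℚ-ring

sumℚ-map-concatMap-replicate : ∀ {A : Set} (f : ℚ → ℚ) k (g : A → ℚ) xs →
  sumℚ (map f (concatMap (λ i → replicate k (g i)) xs)) ≡ ℕ→ℚ k * sumℚ (map (f ∘ g) xs)
sumℚ-map-concatMap-replicate f k g []       = sym (*-zeroʳ (ℕ→ℚ k))
sumℚ-map-concatMap-replicate f k g (x ∷ xs) = begin
  sumℚ (map f (replicate k (g x) ++ rest))            ≡⟨ cong sumℚ (map-++ f (replicate k (g x)) rest) ⟩
  sumℚ (map f (replicate k (g x)) ++ map f rest)      ≡⟨ sumℚ-++ (map f (replicate k (g x))) (map f rest) ⟩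
  sumℚ (map f (replicate k (g x))) + sumℚ (map f rest)
    ≡⟨ cong₂ _+_ (trans (cong sumℚ (map-replicate f k (g x))) (sumℚ-replicate k (f (g x))))
                 (sumℚ-map-concatMap-replicate f k g xs) ⟩
  ℕ→ℚ k * f (g x) + ℕ→ℚ k * sumℚ (map (f ∘ g) xs)      ≡⟨ sym (*-distribˡ-+ (ℕ→ℚ k) (f (g x)) _) ⟩
  ℕ→ℚ k * sumℚ (map (f ∘ g) (x ∷ xs))                 ∎
  where
  open ≡-Reasoning
  rest = concatMap (λ i → replicate k (g i)) xs

sumℚ-map-upTo-suc : ∀ (g : ℕ → ℚ) n → sumℚ (map g (upTo (suc n))) ≡ sumℚ (map g (upTo n)) + g n
sumℚ-map-upTo-suc g n = begin
  sumℚ (map g (upTo (suc n)))                   ≡⟨ cong (sumℚ ∘ map g) (sym (applyUpTo-∷ʳ id n)) ⟩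
  sumℚ (map g (upTo n ++ [ n ]))                 ≡⟨ cong sumℚ (map-++ g (upTo n) [ n ]) ⟩
  sumℚ (map g (upTo n) ++ [ g n ])               ≡⟨ sumℚ-++ (map g (upTo n)) [ g n ] ⟩
  sumℚ (map g (upTo n)) + (g n + 0ℚ)             ≡⟨ cong (sumℚ (map g (upTo n)) +_) (+-identityʳ (g n)) ⟩
  sumℚ (map g (upTo n)) + g n                    ∎
  where open ≡-Reasoning

sumℚ-upTo-telescope : ∀ (h F : ℚ → ℚ) → F 0ℚ ≡ 0ℚ → (∀ x → F (x + 1ℚ) ≡ F x + h (x + 1ℚ)) →
  ∀ n → sumℚ (map (λ i → h (ℕ→ℚ (suc i))) (upTo n)) ≡ F (ℕ→ℚ n)
sumℚ-upTo-telescope h F F0≡0 F-step zero    = sym F0≡0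
sumℚ-upTo-telescope h F F0≡0 F-step (suc n) = begin
  sumℚ (map (h ∘ ℕ→ℚ ∘ suc) (upTo (suc n)))          ≡⟨ sumℚ-map-upTo-suc (h ∘ ℕ→ℚ ∘ suc) n ⟩
  sumℚ (map (h ∘ ℕ→ℚ ∘ suc) (upTo n)) + h (ℕ→ℚ (suc n))
    ≡⟨ cong₂ _+_ (sumℚ-upTo-telescope h F F0≡0 F-step n) (cong h (ℕ→ℚ-suc n)) ⟩
  F (ℕ→ℚ n) + h (ℕ→ℚ n + 1ℚ)                          ≡⟨ sym (F-step (ℕ→ℚ n)) ⟩
  F (ℕ→ℚ n + 1ℚ)                                      ≡⟨ cong F (sym (ℕ→ℚ-suc n)) ⟩
  F (ℕ→ℚ (suc n))                                     ∎
  where open ≡-Reasoning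

sumℚ-shifted : ∀ t n → let N = ℕ→ℚ n in
  sumℚ (map (λ i → ℕ→ℚ (suc i) + t) (upTo n)) ≡ N * t + N * (N + 1ℚ) * ½
sumℚ-shifted t = sumℚ-upTo-telescope (_+ t) F (F-zero t) (F-step t)
  where
  F : ℚ → ℚ
  F N = N * t + N * (N + 1ℚ) * ½
  F-zero : ∀ t → let F = λ N → N * t + N * (N + 1ℚ) * ½ in F 0ℚ ≡ 0ℚ
  F-zero = solve-∀ ℚ-ring
  F-step : ∀ t x → let F = λ N → N * t + N * (N + 1ℚ) * ½ in
    F (x + 1ℚ) ≡ F x + ((x + 1ℚ) + t)
  F-step = solve-∀ ℚ-ring

cube : ℚ → ℚ
cube a = a * a * a

sumℚ-shifted-cubes : ∀ t n → let N = ℕ→ℚ n; T = N * (N + 1ℚ) * ½ in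
  sumℚ (map (λ i → cube (ℕ→ℚ (suc i) + t)) (upTo n)) ≡
    T * T + t * T * (N + N + 1ℚ) + ℕ→ℚ 3 * (t * t) * T + N * (t * t * t)
sumℚ-shifted-cubes t = sumℚ-upTo-telescope (λ x → cube (x + t)) F (F-zero t) (F-step t)
  where
  F : ℚ → ℚ
  F N = let T = N * (N + 1ℚ) * ½ in T * T + t * T * (N + N + 1ℚ) + ℕ→ℚ 3 * (t * t) * T + N * (t * t * t)
  F-zero : ∀ t → let F = λ N → let T = N * (N + 1ℚ) * ½ in
                       T * T + t * T * (N + N + 1ℚ) + ℕ→ℚ 3 * (t * t) * T + N * (t * t * t)
    in F 0ℚ ≡ 0ℚ
  F-zero = solve-∀ ℚ-ring
  F-step : ∀ t x → let F = λ N → let T = N * (N + 1ℚ) * ½ in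
                         T * T + t * T * (N + N + 1ℚ) + ℕ→ℚ 3 * (t * t) * T + N * (t * t * t)
                       y = x + 1ℚ
    in F y ≡ F x + (y + t) * (y + t) * (y + t)
  F-step = solve-∀ ℚ-ring

sumℚ-map-σ : ∀ (f : ℚ → ℚ) n u t →
  sumℚ (map f (σ n u t)) ≡ (ℕ→ℚ u + 1ℚ) * sumℚ (map (λ i → f (ℕ→ℚ (suc i) + t)) (upTo n))
sumℚ-map-σ f n u t = trans (sumℚ-map-concatMap-replicate f (suc u) (λ i → ℕ→ℚ (suc i) + t) (upTo n))
                           (cong (_* _) (ℕ→ℚ-suc u))

mainTheorem5 : (n u : ℕ) → 1 ≤ n → (t : ℚ) →
    ν (σ n u t) ≡
      - ((ℕ→ℚ n * ½) * (ℕ→ℚ u + 1ℚ) * (ℕ→ℚ 2 * t + ℕ→ℚ n + 1ℚ)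
          * (t * (t + 1ℚ) - ℕ→ℚ u * ((ℕ→ℚ n * (ℕ→ℚ n + 1ℚ)) * ½ + ℕ→ℚ n * t)))
mainTheorem5 n u _ t = begin
  ν (σ n u t)                             ≡⟨ cong₂ (λ s₁ s₃ → s₁ * s₁ - s₃) sum≡ cube-sum≡ ⟩
  (U * S₁) * (U * S₁) - U * S₃
    ≡⟨ cong₂ (λ s₁ s₃ → (U * s₁) * (U * s₁) - U * s₃) (sumℚ-shifted t n) (sumℚ-shifted-cubes t n) ⟩
  _                                       ≡⟨ ν-polynomial (ℕ→ℚ u) (ℕ→ℚ n) t ⟩
  _                                       ∎
  where
  open ≡-Reasoning
  U  = ℕ→ℚ u + 1ℚ
  S₁ = sumℚ (map (λ i → ℕ→ℚ (suc i) + t) (upTo n))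
  S₃ = sumℚ (map (λ i → cube (ℕ→ℚ (suc i) + t)) (upTo n))
  sum≡ : sumℚ (σ n u t) ≡ U * S₁
  sum≡ = trans (cong sumℚ (sym (map-id (σ n u t)))) (sumℚ-map-σ id n u t)
  cube-sum≡ : sumℚ (map cube (σ n u t)) ≡ U * S₃
  cube-sum≡ = sumℚ-map-σ cube n u t
  ν-polynomial : ∀ V N t → let U  = V + 1ℚ
                               T  = N * (N + 1ℚ) * ½
                               S₁ = N * t + T
                               S₃ = T * T + t * T * (N + N + 1ℚ) + ℕ→ℚ 3 * (t * t) * T + N * (t * t * t)
    in (U * S₁) * (U * S₁) - U * S₃ ≡
       - ((N * ½) * (V + 1ℚ) * (ℕ→ℚ 2 * t + N + 1ℚ) * (t * (t + 1ℚ) - V * ((N * (N + 1ℚ)) * ½ + N * t)))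
  ν-polynomial = solve-∀ ℚ-ring
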